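{- Let $M$ be an $m\times n$ matrix over $\{ -1,0,1\}$ containing a row equal to $1^n$ and a row of the form $1^r0^s(-1)^t$ for some non-negative integers $r,s,t$ with $r\neq0$ and $t\neq0$. Then $G_o(M)$ is not semi-transitive.
   Context: Rows of matrices are written as strings of length $n$; $x^r$ denotes the symbol $x$ repeated $r$ times. For an $m\times n$ matrix $M=[m_{ij}]$ over $\{ -1,0,1\}$, $G_o(M)$ is the directed graph on vertex set $\{1,\dots,n+m\}$ with edges $j\to i$ for all $1\le j<i\le n$, and for $1\le p\le m$, $1\le j\le n$: an edge $j\to n+p$ if $m_{pj}=1$, an edge $n+p\to j$ if $m_{pj}=-1$, no edge if $m_{pj}=0$; no edges among $n+1,\dots,n+m$. A directed graph is semi-transitive if it is acyclic and for every directed path $u_1\to\cdots\to u_t$, $t\ge2$, either there is no edge $u_1\to u_t$ or all edges $u_i\to u_j$ ($1\le i<j\le t$) exist. -}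

module Defs where

open import Data.Nat using (ℕ; zero; suc; _+_; _<_; _≤_; _≥_)
open import Data.Fin using (Fin; toℕ; splitAt; inject₁; fromℕ; _↑ˡ_; _↑ʳ_) renaming (zero to fz; suc to fs)
open import Data.Sum using (_⊎_; inj₁; inj₂)
open import Data.Product using (Σ; _×_; ∃)
open import Data.Empty using (⊥)
open import Data.Unit using (⊤)
open import Relation.Nullary using (¬_)
open import Relation.Binary.PropositionalEquality using (_≡_)

data Sgn : Set where
  neg zer pos : Sgn

Matrix : ℕ → ℕ → Set
Matrix m n = Fin m → Fin n → Sgn

Digraph : Set → Set₁
Digraph V = V → V → Set

-- vertices of G_o(M): Fin (n + m); index k (0-based) stands for vertex k+1,
-- so the first n are the column vertices 1..n and the last m are n+1..n+m.
EdgeO : ∀ {m n} → Matrix m n → Digraph (Fin (n + m))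
EdgeO {m} {n} M u v with splitAt n u | splitAt n v
... | inj₁ j | inj₁ i = toℕ j < toℕ i
... | inj₁ j | inj₂ p = M p j ≡ pos
... | inj₂ p | inj₁ j = M p j ≡ neg
... | inj₂ p | inj₂ q = ⊥

IsWalk : ∀ {V} → Digraph V → (t : ℕ) → (Fin t → V) → Set
IsWalk E t u = (i : Fin t) (k : Fin t) → suc (toℕ i) ≡ toℕ k → E (u i) (u k)

Acyclic : ∀ {V} → Digraph V → Set
Acyclic {V} E = (t : ℕ) (u : Fin (suc (suc t)) → V) →
  IsWalk E (suc (suc t)) u → ¬ (u fz ≡ u (fromℕ (suc t)))

SemiTransitive : ∀ {V} → Digraph V → Set
SemiTransitive {V} E = Acyclic E ×
  ((t : ℕ) (u : Fin (suc (suc t)) → V) → IsWalk E (suc (suc t)) u →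
     E (u fz) (u (fromℕ (suc t))) →
     (i j : Fin (suc (suc t))) → toℕ i < toℕ j → E (u i) (u j))

AllOnesRow : ∀ {m n} → Matrix m n → Fin m → Set
AllOnesRow M p = ∀ j → M p j ≡ pos

BlockRow : ∀ {m n} → Matrix m n → Fin m → ℕ → ℕ → ℕ → Set
BlockRow {m} {n} M p r s t = (r + s + t ≡ n) ×
  (∀ j → (toℕ j < r → M p j ≡ pos)
       × (r ≤ toℕ j → toℕ j < r + s → M p j ≡ zer)
       × (r + s ≤ toℕ j → M p j ≡ neg))

-- Let p be the all-ones row and q the row 1^r 0^s (-1)^t, and write c₁, cₙ for the first and
-- last column vertices. Then c₁ → q → cₙ → p is a directed path of G_o(M), since row q starts
-- with 1 and ends with -1 and row p is all ones, and c₁ → p is an edge; but no two row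
-- vertices are adjacent, so the edge q → p demanded by semi-transitivity is missing.
module Submission where

open import Defs
open import Data.Nat using (ℕ; zero; suc; _+_; _≤_; z≤n; s≤s; s≤s⁻¹)
open import Data.Nat.Properties using (n≢0⇒n>0; m<m+n; m+n≡0⇒m≡0; suc-injective)
open import Data.Fin using (Fin; toℕ; fromℕ; inject₁; _↑ˡ_; _↑ʳ_) renaming (zero to fz; suc to fs)
open import Data.Fin.Properties using (splitAt-↑ˡ; splitAt-↑ʳ; toℕ-fromℕ; toℕ-inject₁; toℕ-injective)
open import Data.Vec.Functional using ([]; _∷_)
open import Data.Product using (Σ; _×_; ∃; _,_; proj₁; proj₂)
open import Relation.Nullary using (¬_; contradiction)
open import Relation.Binary.PropositionalEquality using (_≡_; _≢_; sym; trans; subst)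

module _ {V : Set} {E : Digraph V} where

  consecutive⇒walk : ∀ {t} (u : Fin (suc t) → V) →
    (∀ (i : Fin t) → E (u (inject₁ i)) (u (fs i))) → IsWalk E (suc t) u
  consecutive⇒walk u step i (fs k) eq
    rewrite toℕ-injective {i = i} {j = inject₁ k} (trans (suc-injective eq) (sym (toℕ-inject₁ k)))
    = step k

  shortcut⇒¬semiTransitive : ∀ (a b c d : V) →
    E a b → E b c → E c d → E a d → ¬ E b d → ¬ SemiTransitive E
  shortcut⇒¬semiTransitive a b c d ab bc cd ad ¬bd (_ , closed) =
    ¬bd (closed 2 (a ∷ b ∷ c ∷ d ∷ []) walk ad (fs fz) (fs (fs (fs fz))) (s≤s (s≤s z≤n)))
    where
    walk : IsWalk E 4 (a ∷ b ∷ c ∷ d ∷ [])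
    walk = consecutive⇒walk _ λ where
      fz             → ab
      (fs fz)        → bc
      (fs (fs fz))   → cd

module _ {m n : ℕ} (M : Matrix m n) where

  col : Fin n → Fin (n + m)
  col j = j ↑ˡ m

  row : Fin m → Fin (n + m)
  row p = n ↑ʳ p

  col→row : ∀ j p → M p j ≡ pos → EdgeO M (col j) (row p)
  col→row j p e rewrite splitAt-↑ˡ n j m | splitAt-↑ʳ n m p = e

  row→col : ∀ j p → M p j ≡ neg → EdgeO M (row p) (col j)
  row→col j p e rewrite splitAt-↑ˡ n j m | splitAt-↑ʳ n m p = e

  ¬row→row : ∀ {p q} → ¬ EdgeO M (row p) (row q)
  ¬row→row {p} {q} e rewrite splitAt-↑ʳ n m p | splitAt-↑ʳ n m q = e

module _ {m : ℕ} {q : Fin m} {r s t : ℕ} where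

  blockRow-empty : {M : Matrix m 0} → BlockRow M q r s t → r ≡ 0
  blockRow-empty (width , _) = m+n≡0⇒m≡0 r (m+n≡0⇒m≡0 (r + s) width)

  blockRow-first : ∀ {n} {M : Matrix m (suc n)} → BlockRow M q r s t → r ≢ 0 → M q fz ≡ pos
  blockRow-first (_ , block) r≢0 = proj₁ (block fz) (n≢0⇒n>0 r≢0)

  blockRow-last : ∀ {n} {M : Matrix m (suc n)} → BlockRow M q r s t → t ≢ 0 → M q (fromℕ n) ≡ neg
  blockRow-last {n} (width , block) t≢0 = proj₂ (proj₂ (block (fromℕ n))) r+s≤last
    where
    r+s≤last : r + s ≤ toℕ (fromℕ n)
    r+s≤last = subst (r + s ≤_) (sym (toℕ-fromℕ n))
      (s≤s⁻¹ (subst (suc (r + s) ≤_) width (m<m+n (r + s) (n≢0⇒n>0 t≢0))))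

corollary2p16 : (m n : ℕ) (M : Matrix m n) →
    (∃ λ (p : Fin m) → AllOnesRow M p) →
    (∃ λ (q : Fin m) → Σ ℕ λ r → Σ ℕ λ s → Σ ℕ λ t →
       (r ≢ 0) × (t ≢ 0) × BlockRow M q r s t) →
    ¬ SemiTransitive (EdgeO M)
corollary2p16 m zero M _ (_ , _ , _ , _ , r≢0 , _ , block) =
  contradiction (blockRow-empty {M = M} block) r≢0
corollary2p16 m (suc n) M (p , ones) (q , r , s , t , r≢0 , t≢0 , block) =
  shortcut⇒¬semiTransitive {E = EdgeO M} (col M fz) (row M q) (col M (fromℕ n)) (row M p)
    (col→row M fz q (blockRow-first {M = M} block r≢0))
    (row→col M (fromℕ n) q (blockRow-last {M = M} block t≢0))
    (col→row M (fromℕ n) p (ones (fromℕ n)))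
    (col→row M fz p (ones fz))
    (¬row→row M)
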